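{- Every graph $G(\phi)$ in the family $\mathcal{G}$ described below is triangle-free.
   Context: Let $M_5$ be the fifth Mycielski graph (obtained from $K_2$ by iterating three times the Mycielski construction: add a shadow vertex for each vertex, join each shadow of $v_i$ to the neighbors of $v_i$, and add a new vertex adjacent to all shadow vertices), with 23 vertices $u_0,\dots,u_{22}$ in the standard order of the construction. Delete $u_{16}$ to get $M'$, and rename its vertices $v_0,\dots,v_{21}$ by shifting indices. Let $I=(t_0,t_1,t_2,t_3)=(v_1,v_3,v_{10},v_{21})$ and $I'=(t_0',t_1',t_2',t_3')=(v_{19},v_{17},v_{11},v_5)$; $I$ and $I'$ are independent sets, and $t_it_j'$ is an edge iff $i\ne j$. Let $H$ be the graph on $a_0,b_0,a_1,b_1,a_2,c_0,c_1,c_2$ with edges $a_0b_0,b_0a_1,a_1b_1,b_1a_2,a_0c_0,a_1c_1,a_2c_2$ (vertices of $a$-, $b$-, $c$-type respectively). For an instance $\phi$ of Monotone Not-All-Equal-3-SAT with variables $x_0,\dots,x_n$ and clauses $S_0,\dots,S_m$, the graph $G(\phi)$ consists of $M'$, an independent set of $x$-type vertices $x_0,\dots,x_n$ each adjacent to $t_2$ and $t_3$, and for each clause $S_j=(x_{j_0},x_{j_1},x_{j_2})$ two copies $H_0,H_1$ of $H$ in which $c_h$ is adjacent to $x_{j_h}$ ($h=0,1,2$). Moreover every $x$-type vertex is adjacent to every $b$-type vertex, every $b$-type vertex is adjacent to $t_0',t_1'$, every $c$-type vertex to $t_2',t_3'$; in copies $H_0$ add edges $a_0t_0,a_0t_2,a_1t_0,a_2t_0,a_2t_3$,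 and in copies $H_1$ add edges $a_0t_1,a_0t_2,a_1t_1,a_2t_1,a_2t_3$. $\mathcal{G}=\{G(\phi)\}$ over all instances $\phi$. -}

module Defs where

open import Data.Nat using (ℕ; zero; suc; _+_; _*_; _∸_; _<ᵇ_; _≡ᵇ_)
open import Data.Bool using (Bool; true; false; if_then_else_; _∧_; _∨_)
open import Data.Fin using (Fin; toℕ)
open import Data.Product using (_×_)
open import Data.Unit using (⊤)
open import Data.Empty using (⊥)
open import Data.Sum using (_⊎_)
open import Relation.Binary.PropositionalEquality using (_≡_)
open import Relation.Nullary using (¬_)

-- Graphs given by a Boolean adjacency function on ℕ (vertices 0..N-1).

-- One step of the Mycielski construction applied to a graph on the
-- vertices 0..k-1 with adjacency e.  Result has vertices 0..2k:
-- i < k original, k+i is the shadow of i, 2k is the new apex.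
myc : ℕ → (ℕ → ℕ → Bool) → ℕ → ℕ → Bool
myc k e i j =
  if i <ᵇ k then
    (if j <ᵇ k then e i j else if j <ᵇ (k + k) then e i (j ∸ k) else false)
  else if i <ᵇ (k + k) then
    (if j <ᵇ k then e (i ∸ k) j else if j <ᵇ (k + k) then false else (j ≡ᵇ (k + k)))
  else if i ≡ᵇ (k + k) then
    (if j <ᵇ k then false else j <ᵇ (k + k))
  else false

K2adj : ℕ → ℕ → Bool
K2adj i j = ((i ≡ᵇ 0) ∧ (j ≡ᵇ 1)) ∨ ((i ≡ᵇ 1) ∧ (j ≡ᵇ 0))

-- M₃ = C₅ (5 vertices), M₄ = Grötzsch graph (11), M₅ (23 vertices u₀..u₂₂).
M3adj M4adj M5adj : ℕ → ℕ → Bool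
M3adj = myc 2 K2adj
M4adj = myc 5 M3adj
M5adj = myc 11 M4adj

-- M' = M₅ - u₁₆, vertices v₀..v₂₁ (v_i = u_i for i < 16, v_i = u_{i+1} otherwise).
shift : Fin 22 → ℕ
shift i = if toℕ i <ᵇ 16 then toℕ i else suc (toℕ i)

M'adj : Fin 22 → Fin 22 → Bool
M'adj i j = M5adj (shift i) (shift j)

t0 t1 t2 t3 t0' t1' t2' t3' : Fin 22
t0 = Data.Fin.fromℕ 1 Data.Fin.↑ˡ 20
t1 = Data.Fin.fromℕ 3 Data.Fin.↑ˡ 18
t2 = Data.Fin.fromℕ 10 Data.Fin.↑ˡ 11
t3 = Data.Fin.fromℕ 21
t0' = Data.Fin.fromℕ 19 Data.Fin.↑ˡ 2
t1' = Data.Fin.fromℕ 17 Data.Fin.↑ˡ 4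
t2' = Data.Fin.fromℕ 11 Data.Fin.↑ˡ 10
t3' = Data.Fin.fromℕ 5 Data.Fin.↑ˡ 16

data HV : Set where
  a0 b0 a1 b1 a2 c0 c1 c2 : HV

data HEdge : HV → HV → Set where
  a0b0 : HEdge a0 b0
  b0a1 : HEdge b0 a1
  a1b1 : HEdge a1 b1
  b1a2 : HEdge b1 a2
  a0c0 : HEdge a0 c0
  a1c1 : HEdge a1 c1
  a2c2 : HEdge a2 c2

isB : HV → Set
isB b0 = ⊤
isB b1 = ⊤
isB _  = ⊥

data IsC : HV → Fin 3 → Set where
  isc0 : IsC c0 (Data.Fin.fromℕ 0 Data.Fin.↑ˡ 2)
  isc1 : IsC c1 (Data.Fin.fromℕ 1 Data.Fin.↑ˡ 1)
  isc2 : IsC c2 (Data.Fin.fromℕ 2)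

isC : HV → Set
isC c0 = ⊤
isC c1 = ⊤
isC c2 = ⊤
isC _  = ⊥

-- Edges from the a-vertices of copy H₀ (copy index 0) resp. H₁ (copy index 1) to M'.
data AEdge : Fin 2 → HV → Fin 22 → Set where
  h0-a0t0 : AEdge Data.Fin.zero a0 t0
  h0-a0t2 : AEdge Data.Fin.zero a0 t2
  h0-a1t0 : AEdge Data.Fin.zero a1 t0
  h0-a2t0 : AEdge Data.Fin.zero a2 t0
  h0-a2t3 : AEdge Data.Fin.zero a2 t3
  h1-a0t1 : AEdge (Data.Fin.suc Data.Fin.zero) a0 t1
  h1-a0t2 : AEdge (Data.Fin.suc Data.Fin.zero) a0 t2
  h1-a1t1 : AEdge (Data.Fin.suc Data.Fin.zero) a1 t1
  h1-a2t1 : AEdge (Data.Fin.suc Data.Fin.zero) a2 t1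
  h1-a2t3 : AEdge (Data.Fin.suc Data.Fin.zero) a2 t3

-- Instances of Monotone NAE-3-SAT: variables x₀..xₙ, clauses S₀..Sₘ,
-- clause S_j = (x_{j₀}, x_{j₁}, x_{j₂}) given by  clause j h = j_h.

record Instance : Set where
  field
    n m    : ℕ
    clause : Fin (suc m) → Fin 3 → Fin (suc n)

module _ (φ : Instance) where
  open Instance φ

  data Vertex : Set where
    mv : Fin 22 → Vertex
    xv : Fin (suc n) → Vertex
    hv : Fin (suc m) → Fin 2 → HV → Vertex     -- clause j, copy H₀/H₁, vertex of H

  data Edge : Vertex → Vertex → Set where
    e-M   : ∀ {i k} → M'adj i k ≡ true → Edge (mv i) (mv k)
    e-xt2 : ∀ {k} → Edge (xv k) (mv t2)
    e-xt3 : ∀ {k} → Edge (xv k) (mv t3)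
    e-H   : ∀ {j c p q} → HEdge p q → Edge (hv j c p) (hv j c q)
    e-cx  : ∀ {j c p h} → IsC p h → Edge (hv j c p) (xv (clause j h))
    e-xb  : ∀ {k j c p} → isB p → Edge (xv k) (hv j c p)
    e-bt0' : ∀ {j c p} → isB p → Edge (hv j c p) (mv t0')
    e-bt1' : ∀ {j c p} → isB p → Edge (hv j c p) (mv t1')
    e-ct2' : ∀ {j c p} → isC p → Edge (hv j c p) (mv t2')
    e-ct3' : ∀ {j c p} → isC p → Edge (hv j c p) (mv t3')
    e-at  : ∀ {j c p t} → AEdge c p t → Edge (hv j c p) (mv t)

  Adj : Vertex → Vertex → Set
  Adj u v = Edge u v ⊎ Edge v u

TriangleFree : (φ : Instance) → Set
TriangleFree φ = ∀ (u v w : Vertex φ) → ¬ (u ≡ v) → ¬ (v ≡ w) → ¬ (u ≡ w) →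
  ¬ (Adj φ u v × Adj φ v w × Adj φ u w)

{-# OPTIONS --safe #-}
-- Let φ₀ be the instance with one variable and the single clause (x₀, x₀, x₀).
-- Sending every x-vertex to x₀ and every clause gadget to the gadget of the
-- unique clause of φ₀ is a graph homomorphism G(φ) → G(φ₀): the x-vertices are
-- independent, gadgets of different clauses are not joined, and all other edges
-- are the same in every G(φ). A homomorphism into a loopless graph maps a
-- triangle onto a triangle, and the fixed 39-vertex graph G(φ₀) is
-- triangle-free by exhaustive computation.
module Submission where

open import Defs
open import Data.Bool using (Bool; true; false; T; not; _∧_; _∨_)
open import Data.Bool.Properties using (T-∧; T-∨; T-≡)
open import Data.Bool.ListAction using (all)
open import Data.Fin using (Fin; zero; suc; _≟_)
open import Data.List using (List; []; _∷_; _++_; map; allFin; cartesianProductWith)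
open import Data.List.Membership.Propositional using (_∈_)
open import Data.List.Membership.Propositional.Properties
  using (∈-map⁺; ∈-++⁺ˡ; ∈-++⁺ʳ; ∈-allFin; ∈-cartesianProductWith⁺)
open import Data.List.Membership.DecPropositional (_≟_ {22}) using (_∈?_)
open import Data.List.Relation.Unary.Any using (here; there)
open import Data.List.Relation.Unary.All using (lookup)
open import Data.List.Relation.Unary.All.Properties using (all⁺)
open import Data.Product using (_×_; _,_)
open import Data.Unit using (tt)
open import Data.Sum using () renaming (map to map-⊎)
open import Function.Base using (_∘_)
open import Function.Bundles using (Equivalence)
open import Relation.Binary.PropositionalEquality using (refl)
open import Relation.Nullary using (¬_)
open import Relation.Nullary.Decidable using (⌊_⌋; fromWitness)

NoTriangle : {A : Set} → (A → A → Set) → Set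
NoTriangle R = ∀ a b c → ¬ (R a b × R b c × R a c)

noTriangle-pullback : {A B : Set} {R : A → A → Set} {S : B → B → Set} (f : A → B) →
                      (∀ {a b} → R a b → S (f a) (f b)) → NoTriangle S → NoTriangle R
noTriangle-pullback f hom noTriangle a b c (ab , bc , ac) =
  noTriangle (f a) (f b) (f c) (hom ab , hom bc , hom ac)

T-not⇒¬T : ∀ {x} → T (not x) → ¬ T x
T-not⇒¬T {false} _ ()

module Enumeration {A : Set} (xs : List A) (complete : ∀ a → a ∈ xs) where

  all-sound : (p : A → Bool) → T (all p xs) → ∀ a → T (p a)
  all-sound p holds a = lookup (all⁺ p xs holds) (complete a)

  noTriangleᵇ : (A → A → Bool) → Bool
  noTriangleᵇ r = all (λ a → all (λ b → all (λ c → not (r a b ∧ r b c ∧ r a c)) xs) xs) xs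

  noTriangle-byEnumeration : (r : A → A → Bool) → T (noTriangleᵇ r) →
                             NoTriangle (λ a b → T (r a b))
  noTriangle-byEnumeration r holds a b c (ab , bc , ac) =
    T-not⇒¬T (all-sound _ (all-sound _ (all-sound _ holds a) b) c)
             (Equivalence.from T-∧ (ab , Equivalence.from T-∧ (bc , ac)))

φ₀ : Instance
φ₀ = record { n = 0 ; m = 0 ; clause = λ _ _ → zero }

collapse : (φ : Instance) → Vertex φ → Vertex φ₀
collapse φ (mv i)     = mv i
collapse φ (xv _)     = xv zero
collapse φ (hv _ c p) = hv zero c p

collapse-edge : (φ : Instance) → ∀ {u v} → Edge φ u v → Edge φ₀ (collapse φ u) (collapse φ v)
collapse-edge φ (e-M i~k)   = e-M i~k
collapse-edge φ e-xt2       = e-xt2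
collapse-edge φ e-xt3       = e-xt3
collapse-edge φ (e-H pq)    = e-H pq
collapse-edge φ (e-cx ch)   = e-cx ch
collapse-edge φ (e-xb b)    = e-xb b
collapse-edge φ (e-bt0' b)  = e-bt0' b
collapse-edge φ (e-bt1' b)  = e-bt1' b
collapse-edge φ (e-ct2' c)  = e-ct2' c
collapse-edge φ (e-ct3' c)  = e-ct3' c
collapse-edge φ (e-at at)   = e-at at

collapse-adj : (φ : Instance) → ∀ {u v} → Adj φ u v → Adj φ₀ (collapse φ u) (collapse φ v)
collapse-adj φ = map-⊎ (collapse-edge φ) (collapse-edge φ)

hEdgeᵇ : HV → HV → Bool
hEdgeᵇ a0 b0 = true
hEdgeᵇ b0 a1 = true
hEdgeᵇ a1 b1 = true
hEdgeᵇ b1 a2 = true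
hEdgeᵇ a0 c0 = true
hEdgeᵇ a1 c1 = true
hEdgeᵇ a2 c2 = true
hEdgeᵇ _  _  = false

hEdgeᵇ-sound : ∀ {p q} → HEdge p q → T (hEdgeᵇ p q)
hEdgeᵇ-sound a0b0 = _
hEdgeᵇ-sound b0a1 = _
hEdgeᵇ-sound a1b1 = _
hEdgeᵇ-sound b1a2 = _
hEdgeᵇ-sound a0c0 = _
hEdgeᵇ-sound a1c1 = _
hEdgeᵇ-sound a2c2 = _

isBᵇ : HV → Bool
isBᵇ b0 = true
isBᵇ b1 = true
isBᵇ _  = false

isCᵇ : HV → Bool
isCᵇ c0 = true
isCᵇ c1 = true
isCᵇ c2 = true
isCᵇ _  = false

neighboursInM' : Fin 2 → HV → List (Fin 22)
neighboursInM' _ b0 = t0' ∷ t1' ∷ []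
neighboursInM' _ b1 = t0' ∷ t1' ∷ []
neighboursInM' _ c0 = t2' ∷ t3' ∷ []
neighboursInM' _ c1 = t2' ∷ t3' ∷ []
neighboursInM' _ c2 = t2' ∷ t3' ∷ []
neighboursInM' zero       a0 = t0 ∷ t2 ∷ []
neighboursInM' zero       a1 = t0 ∷ []
neighboursInM' zero       a2 = t0 ∷ t3 ∷ []
neighboursInM' (suc zero) a0 = t1 ∷ t2 ∷ []
neighboursInM' (suc zero) a1 = t1 ∷ []
neighboursInM' (suc zero) a2 = t1 ∷ t3 ∷ []

edgeᵇ : Vertex φ₀ → Vertex φ₀ → Bool
edgeᵇ (mv i)     (mv k)     = M'adj i k
edgeᵇ (xv _)     (mv k)     = ⌊ k ∈? t2 ∷ t3 ∷ [] ⌋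
edgeᵇ (xv _)     (hv _ _ p) = isBᵇ p
edgeᵇ (hv _ _ p) (xv _)     = isCᵇ p
edgeᵇ (hv _ c p) (hv _ d q) = ⌊ c ≟ d ⌋ ∧ hEdgeᵇ p q
edgeᵇ (hv _ c p) (mv t)     = ⌊ t ∈? neighboursInM' c p ⌋
edgeᵇ _          _          = false

edgeᵇ-sound : ∀ {u v} → Edge φ₀ u v → T (edgeᵇ u v)
edgeᵇ-sound (e-M i~k)           = Equivalence.from T-≡ i~k
edgeᵇ-sound e-xt2               = _
edgeᵇ-sound e-xt3               = _
edgeᵇ-sound (e-H pq)            = Equivalence.from T-∧ (fromWitness refl , hEdgeᵇ-sound pq)
edgeᵇ-sound (e-cx isc0)         = _
edgeᵇ-sound (e-cx isc1)         = _
edgeᵇ-sound (e-cx isc2)         = _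
edgeᵇ-sound (e-xb {p = b0} _)   = _
edgeᵇ-sound (e-xb {p = b1} _)   = _
edgeᵇ-sound (e-bt0' {p = b0} _) = _
edgeᵇ-sound (e-bt0' {p = b1} _) = _
edgeᵇ-sound (e-bt1' {p = b0} _) = _
edgeᵇ-sound (e-bt1' {p = b1} _) = _
edgeᵇ-sound (e-ct2' {p = c0} _) = _
edgeᵇ-sound (e-ct2' {p = c1} _) = _
edgeᵇ-sound (e-ct2' {p = c2} _) = _
edgeᵇ-sound (e-ct3' {p = c0} _) = _
edgeᵇ-sound (e-ct3' {p = c1} _) = _
edgeᵇ-sound (e-ct3' {p = c2} _) = _
edgeᵇ-sound (e-at h0-a0t0)      = _
edgeᵇ-sound (e-at h0-a0t2)      = _
edgeᵇ-sound (e-at h0-a1t0)      = _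
edgeᵇ-sound (e-at h0-a2t0)      = _
edgeᵇ-sound (e-at h0-a2t3)      = _
edgeᵇ-sound (e-at h1-a0t1)      = _
edgeᵇ-sound (e-at h1-a0t2)      = _
edgeᵇ-sound (e-at h1-a1t1)      = _
edgeᵇ-sound (e-at h1-a2t1)      = _
edgeᵇ-sound (e-at h1-a2t3)      = _

adjᵇ : Vertex φ₀ → Vertex φ₀ → Bool
adjᵇ u v = edgeᵇ u v ∨ edgeᵇ v u

adjᵇ-sound : ∀ {u v} → Adj φ₀ u v → T (adjᵇ u v)
adjᵇ-sound = Equivalence.from T-∨ ∘ map-⊎ edgeᵇ-sound edgeᵇ-sound

hVertices : List HV
hVertices = a0 ∷ b0 ∷ a1 ∷ b1 ∷ a2 ∷ c0 ∷ c1 ∷ c2 ∷ []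

∈-hVertices : ∀ p → p ∈ hVertices
∈-hVertices a0 = here refl
∈-hVertices b0 = there (here refl)
∈-hVertices a1 = there (there (here refl))
∈-hVertices b1 = there (there (there (here refl)))
∈-hVertices a2 = there (there (there (there (here refl))))
∈-hVertices c0 = there (there (there (there (there (here refl)))))
∈-hVertices c1 = there (there (there (there (there (there (here refl))))))
∈-hVertices c2 = there (there (there (there (there (there (there (here refl)))))))

vertices₀ : List (Vertex φ₀)
vertices₀ = map mv (allFin 22) ++ xv zero ∷ cartesianProductWith (hv zero) (allFin 2) hVertices

∈-vertices₀ : ∀ v → v ∈ vertices₀
∈-vertices₀ (mv i)        = ∈-++⁺ˡ (∈-map⁺ mv (∈-allFin i))
∈-vertices₀ (xv zero)     = ∈-++⁺ʳ (map mv (allFin 22)) (here refl)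
∈-vertices₀ (hv zero c p) =
  ∈-++⁺ʳ (map mv (allFin 22)) (there (∈-cartesianProductWith⁺ (hv zero) (∈-allFin c) (∈-hVertices p)))

open Enumeration vertices₀ ∈-vertices₀

adjᵇ-noTriangle : NoTriangle (λ u v → T (adjᵇ u v))
adjᵇ-noTriangle = noTriangle-byEnumeration adjᵇ tt

proposition1 : (φ : Instance) → TriangleFree φ
proposition1 φ u v w _ _ _ =
  noTriangle-pullback (collapse φ) (adjᵇ-sound ∘ collapse-adj φ) adjᵇ-noTriangle u v w
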